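{- Let $\mathcal A=\{e_i\leftrightarrow A_i\}_{i<n}$ be a set of positive extension axioms. Every positive eNDT formula $A$ whose extension variables are among $e_0,\dots,e_{n-1}$ computes a monotone Boolean function with respect to $\mathcal A$; that is, if $\alpha\le\beta$ (meaning $\alpha(p)\le\beta(p)$ for every propositional variable $p$) and $\alpha\models_{\mathcal A}A$, then $\beta\models_{\mathcal A}A$.
   Context: eNDT formulas: built from propositional variables, constants $0,1$ and extension variables $e_0,e_1,\dots$ by binary $\vee$ and decisions $\mathrm{dec}(A,p,B)$ with $p$ a propositional variable. A set of extension axioms is $\{e_i\leftrightarrow A_i\}_{i<n}$ with each $A_i$ containing only extension variables among $e_0,\dots,e_{i-1}$. Satisfaction $\alpha\models_{\mathcal A}$ for an assignment $\alpha$ of propositional variables to $\{0,1\}$: $\alpha\not\models_{\mathcal A}0$; $\alpha\models_{\mathcal A}1$; $\alpha\models_{\mathcal A}p$ iff $\alpha(p)=1$; $\alpha\models_{\mathcal A}A\vee B$ iff $\alpha\models_{\mathcal A}A$ or $\alpha\models_{\mathcal A}B$; $\alpha\models_{\mathcal A}\mathrm{dec}(A,p,B)$ iff ($\alpha(p)=0$ and $\alpha\models_{\mathcal A}A$) or ($\alpha(p)=1$ and $\alpha\models_{\mathcal A}B$); $\alpha\models_{\mathcal A}e_i$ iff $\alpha\models_{\mathcal A}A_i$. A formula is positive if each decision subformula has the form $\mathrm{dec}(A,p,A\vee C)$ for some $C$; $\mathcal A$ is positive if each $A_i$ is positive. -}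

module Defs where

open import Data.Nat using (ℕ; zero; suc)
open import Data.Fin using (Fin; zero; suc)
open import Data.Maybe using (Maybe; just; nothing)
import Data.Maybe
open import Data.Bool using (Bool; true; false; T)
open import Data.Empty using (⊥)
open import Data.Unit using (⊤)
open import Data.Sum using (_⊎_)
open import Data.Product using (_×_)
open import Relation.Binary.PropositionalEquality using (_≡_)

Var : Set
Var = ℕ

data Form (m : ℕ) : Set where
  ⊥f  : Form m
  ⊤f  : Form m
  var : Var → Form m
  ext : Fin m → Form m
  _∨f_ : Form m → Form m → Form m
  dec : Form m → Var → Form m → Form m

data Positive {m : ℕ} : Form m → Set where
  pos⊥   : Positive ⊥f
  pos⊤   : Positive ⊤f
  posVar : (p : Var) → Positive (var p)
  posExt : (i : Fin m) → Positive (ext i)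
  pos∨   : {A B : Form m} → Positive A → Positive B → Positive (A ∨f B)
  posDec : {A C : Form m} (p : Var) → Positive A → Positive C →
           Positive (dec A p (A ∨f C))

-- A set of extension axioms {e_i ↔ A_i}_{i<n}, where A_i only mentions
-- e_0, …, e_{i-1}.  Built as a snoc-list: (𝒜 ▷ A) adds the axiom e_i ↔ A.
data Axioms : ℕ → Set where
  ∅   : Axioms zero
  _▷_ : {i : ℕ} → Axioms i → Form i → Axioms (suc i)

data Positive𝒜 : {n : ℕ} → Axioms n → Set where
  pos∅ : Positive𝒜 ∅
  pos▷ : {i : ℕ} {𝒜 : Axioms i} {A : Form i} →
         Positive𝒜 𝒜 → Positive A → Positive𝒜 (𝒜 ▷ A)

Assignment : Set
Assignment = Var → Bool

_≤ₐ_ : Assignment → Assignment → Set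
α ≤ₐ β = (p : Var) → T (α p) → T (β p)

-- Classify an index j < i+1: either j = i (the last axiom), or j < i.
-- Returns nothing for j = i and just j' (j' < i, same value) otherwise.
splitLast : {i : ℕ} → Fin (suc i) → Maybe (Fin i)
splitLast {zero} zero = nothing
splitLast {suc i} zero = just zero
splitLast {suc i} (suc j) = Data.Maybe.map suc (splitLast {i} j)

-- For 𝒜 ▷ A_i, α ⊨ e_i iff α ⊨ A_i (evaluated w.r.t. the earlier axioms,
-- which are the only ones A_i mentions); α ⊨ e_j (j < i) is evaluated
-- w.r.t. the earlier axioms.
mutual
  sat : {n : ℕ} → Axioms n → Assignment → Form n → Set
  sat 𝒜 α ⊥f = ⊥
  sat 𝒜 α ⊤f = ⊤
  sat 𝒜 α (var p) = T (α p)
  sat 𝒜 α (ext i) = satExt 𝒜 α i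
  sat 𝒜 α (A ∨f B) = sat 𝒜 α A ⊎ sat 𝒜 α B
  sat 𝒜 α (dec A p B) = (α p ≡ false × sat 𝒜 α A) ⊎ (α p ≡ true × sat 𝒜 α B)

  satExt : {n : ℕ} → Axioms n → Assignment → Fin n → Set
  satExt (𝒜 ▷ A) α j = satExt′ 𝒜 A α (splitLast j)

  satExt′ : {i : ℕ} → Axioms i → Form i → Assignment → Maybe (Fin i) → Set
  satExt′ 𝒜 A α nothing = sat 𝒜 α A
  satExt′ 𝒜 A α (just j) = satExt 𝒜 α j

_⊨[_]_ : {n : ℕ} → Assignment → Axioms n → Form n → Set
α ⊨[ 𝒜 ] A = sat 𝒜 α A

{-# OPTIONS --safe #-}
module Submission where

open import Defs
open import Data.Nat using (ℕ)
open import Data.Fin using (Fin)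
open import Data.Maybe using (Maybe; just; nothing)
open import Data.Bool using (true; false)
open import Data.Bool.Properties using (T-≡)
open import Data.Sum using (inj₁; inj₂)
open import Data.Product using (_,_)
open import Function.Bundles using (Equivalence)
open import Relation.Binary.PropositionalEquality using (refl)

Monotone : (Assignment → Set) → Set
Monotone P = ∀ {α β} → α ≤ₐ β → P α → P β

mutual
  sat-mono : {n : ℕ} {𝒜 : Axioms n} {A : Form n} →
    Positive𝒜 𝒜 → Positive A → Monotone (λ α → α ⊨[ 𝒜 ] A)
  sat-mono P𝒜 pos⊤ α≤β s = s
  sat-mono P𝒜 (posVar p) α≤β s = α≤β p s
  sat-mono P𝒜 (posExt i) α≤β s = satExt-mono P𝒜 i α≤β s
  sat-mono P𝒜 (pos∨ PA PB) α≤β (inj₁ s) = inj₁ (sat-mono P𝒜 PA α≤β s)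
  sat-mono P𝒜 (pos∨ PA PB) α≤β (inj₂ s) = inj₂ (sat-mono P𝒜 PB α≤β s)
  -- Positivity is what makes the 0-branch safe: A is also a disjunct of the 1-branch.
  sat-mono P𝒜 (posDec p PA PC) {β = β} α≤β (inj₁ (_ , s)) with β p
  ... | false = inj₁ (refl , sat-mono P𝒜 PA α≤β s)
  ... | true  = inj₂ (refl , inj₁ (sat-mono P𝒜 PA α≤β s))
  sat-mono P𝒜 (posDec p PA PC) α≤β (inj₂ (αp≡1 , s)) =
    inj₂ ( Equivalence.to T-≡ (α≤β p (Equivalence.from T-≡ αp≡1))
         , sat-mono P𝒜 (pos∨ PA PC) α≤β s )

  satExt-mono : {n : ℕ} {𝒜 : Axioms n} → Positive𝒜 𝒜 →
    (j : Fin n) → Monotone (λ α → satExt 𝒜 α j)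
  satExt-mono (pos▷ P𝒜 PA) j = satExt′-mono P𝒜 PA (splitLast j)

  satExt′-mono : {i : ℕ} {𝒜 : Axioms i} {A : Form i} → Positive𝒜 𝒜 → Positive A →
    (j : Maybe (Fin i)) → Monotone (λ α → satExt′ 𝒜 A α j)
  satExt′-mono P𝒜 PA nothing  = sat-mono P𝒜 PA
  satExt′-mono P𝒜 PA (just j) = satExt-mono P𝒜 j

mainTheorem7 : (n : ℕ) (𝒜 : Axioms n) → Positive𝒜 𝒜 →
    (A : Form n) → Positive A →
    (α β : Assignment) → α ≤ₐ β → α ⊨[ 𝒜 ] A → β ⊨[ 𝒜 ] A
mainTheorem7 n 𝒜 P𝒜 A PA α β α≤β = sat-mono P𝒜 PA α≤β
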